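{- For any graph $G$, ${\sf tpm}(G)\ge\left\lfloor\frac{{\sf nm}(G)+1}{2}\right\rfloor$.
   Context: All graphs are finite, undirected, simple. A triangle-path of length $t$ is the graph consisting of $t$ vertex-disjoint triangles on vertex sets $\{a_i,b_i,c_i\}$, $i\in[t]$, together with the $t-1$ edges $\{b_i,a_{i+1}\}$, $i\in[t-1]$. ${\sf tpm}(G)$ is the largest length of a triangle-path contained in $G$ as a minor, or $0$ if none. The necklace $N_t$ is the multigraph on $v_1,\dots,v_{t+1}$ with two parallel edges between $v_i$ and $v_{i+1}$ for $i\in[t]$; $G$ contains $N_t$ as a minor iff there are $t+1$ pairwise disjoint vertex sets $S_1,\dots,S_{t+1}$, each inducing a connected subgraph, with at least two edges between $S_i$ and $S_{i+1}$ for each $i\in[t]$. ${\sf nm}(G)$ is the largest such $t$, or $0$ if none. -}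

module Defs where

open import Data.Nat using (ℕ; zero; suc; _≤_)
open import Data.Fin using (Fin; toℕ; inject₁) renaming (suc to fsuc; zero to fzero)
open import Data.Fin.Subset using (Subset; _∈_)
open import Data.Product using (Σ; ∃; ∃-syntax; _×_; _,_)
open import Data.Sum using (_⊎_)
open import Relation.Nullary using (¬_)
open import Relation.Binary.PropositionalEquality using (_≡_; _≢_)

record Graph : Set₁ where
  field
    n      : ℕ
    Adj    : Fin n → Fin n → Set
    sym    : ∀ {u v} → Adj u v → Adj v u
    irrefl : ∀ {u} → ¬ Adj u u
open Graph public

module _ (G : Graph) where

  data PathIn (S : Subset (n G)) : Fin (n G) → Fin (n G) → Set where
    here : ∀ {u} → u ∈ S → PathIn S u u
    step : ∀ {u w v} → u ∈ S → Adj G u w → PathIn S w v → PathIn S u v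

  Connected : Subset (n G) → Set
  Connected S = (∃[ v ] v ∈ S) × (∀ {u v} → u ∈ S → v ∈ S → PathIn S u v)

  EdgeBetween : Subset (n G) → Subset (n G) → Set
  EdgeBetween S T = ∃[ x ] ∃[ y ] (x ∈ S × y ∈ T × Adj G x y)

  TwoEdgesBetween : Subset (n G) → Subset (n G) → Set
  TwoEdgesBetween S T =
    ∃[ x ] ∃[ y ] ∃[ x' ] ∃[ y' ]
      (x ∈ S × y ∈ T × Adj G x y × x' ∈ S × y' ∈ T × Adj G x' y' × (x ≢ x' ⊎ y ≢ y'))

  record MinorModel (HV : Set) (HE : HV → HV → Set) : Set where
    field
      branch    : HV → Subset (n G)
      connected : ∀ h → Connected (branch h)
      disjoint  : ∀ h h' {v} → v ∈ branch h → v ∈ branch h' → h ≡ h'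
      edges     : ∀ {h h'} → HE h h' → EdgeBetween (branch h) (branch h')

  HasMinor : (HV : Set) → (HV → HV → Set) → Set
  HasMinor HV HE = MinorModel HV HE

-- Triangle-path of length t: vertices (i , k) with i ∈ Fin t, k ∈ Fin 3,
-- where k = 0,1,2 stand for a_i, b_i, c_i.  Edges: all pairs inside a
-- triangle, and b_i a_{i+1}  (in both orientations).
Idx0 Idx1 : Fin 3
Idx0 = fzero
Idx1 = fsuc fzero

TPVertex : ℕ → Set
TPVertex t = Fin t × Fin 3

TPEdge : (t : ℕ) → TPVertex t → TPVertex t → Set
TPEdge t (i , k) (j , l) =
    (i ≡ j × k ≢ l)
  ⊎ (toℕ j ≡ suc (toℕ i) × k ≡ Idx1 × l ≡ Idx0)
  ⊎ (toℕ i ≡ suc (toℕ j) × l ≡ Idx1 × k ≡ Idx0)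

HasTrianglePathMinor : Graph → ℕ → Set
HasTrianglePathMinor G t = HasMinor G (TPVertex t) (TPEdge t)

HasNecklaceMinor : Graph → ℕ → Set
HasNecklaceMinor G t =
  Σ (Fin (suc t) → Subset (n G)) λ S →
      (∀ i → Connected G (S i))
    × (∀ i j {v} → v ∈ S i → v ∈ S j → i ≡ j)
    × (∀ (i : Fin t) → TwoEdgesBetween G (S (inject₁ i)) (S (fsuc i)))

IsLargest : (ℕ → Set) → ℕ → Set
IsLargest P k = (P k ⊎ (k ≡ 0 × (∀ t → ¬ P t))) × (∀ t → P t → t ≤ k)

IsTPM : Graph → ℕ → Set
IsTPM G k = IsLargest (λ t → 1 ≤ t × HasTrianglePathMinor G t) k

IsNM : Graph → ℕ → Set
IsNM G k = IsLargest (λ t → 1 ≤ t × HasNecklaceMinor G t) k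

{-# OPTIONS --safe #-}

-- Pair the beads S₂ᵢ, S₂ᵢ₊₁ of a necklace of length k, for i < ⌊(k+1)/2⌋. The two edges
-- between a pair have distinct ends on one side, say x ≠ x' in S₂ᵢ. Cutting S₂ᵢ into two
-- adjacent connected parts, one containing x and the other x', and keeping S₂ᵢ₊₁ whole gives
-- a triangle minor. The parts can be grown to cover any prescribed vertex, so the triangle
-- can be made to contain the ends of the edges S₂ᵢ₋₁S₂ᵢ and S₂ᵢ₊₁S₂ᵢ₊₂, and these edges link
-- consecutive triangles into a triangle-path.

module Submission where

open import Data.Empty using (⊥; ⊥-elim)
open import Data.Fin using (Fin; toℕ; fromℕ<; inject₁; _≟_) renaming (zero to fzero; suc to fsuc)
open import Data.Fin.Properties using (toℕ<n; toℕ-injective; toℕ-fromℕ<; toℕ-inject₁)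
open import Data.Fin.Subset using (Subset; _∈_; _∉_; _⊆_; ⁅_⁆; _∪_; _∩_; ∁)
open import Data.Fin.Subset.Properties
  using (_∈?_; ⊆-refl; x∈⁅x⁆; x∈⁅y⁆⇒x≡y; x∈p∪q⁻; p⊆p∪q; q⊆p∪q; x∈p∩q⁺; x∈p∩q⁻; x∉p⇒x∈∁p; x∈∁p⇒x∉p)
open import Data.Nat using (ℕ; zero; suc; _≤_; _<_; _*_; _/_; z≤n; s≤s; _<?_)
open import Data.Nat.Properties
  using (≤-trans; ≤-pred; <⇒≤; <⇒≢; n<1+n; suc-injective; *-cancelʳ-≡; *-monoˡ-≤; m⊓n≤n; m≤n⇒m⊓n≡m)
open import Data.Nat.DivMod using (m/n*n≤m)
open import Data.Product using (Σ; ∃₂; ∃-syntax; _×_; _,_; proj₁; proj₂)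
open import Data.Sum using (_⊎_; inj₁; inj₂; [_,_]′)
open import Data.Vec using (lookup; _∷_; [])
open import Function using (_∘_)
open import Relation.Nullary using (yes; no; contradiction)
open import Relation.Binary.PropositionalEquality
  using (_≡_; _≢_; refl; sym; trans; cong; subst; subst₂; module ≡-Reasoning)

open import Defs hiding (sym)

Idx2 : Fin 3
Idx2 = fsuc (fsuc fzero)

K₃-relation : (R : Fin 3 → Fin 3 → Set) → (∀ {a b} → R a b → R b a) →
              R Idx0 Idx1 → R Idx0 Idx2 → R Idx1 Idx2 → ∀ {a b} → a ≢ b → R a b
K₃-relation R R-sym r01 r02 r12 {fzero}               {fzero}               0≢0 = contradiction refl 0≢0
K₃-relation R R-sym r01 r02 r12 {fzero}               {fsuc fzero}          _   = r01
K₃-relation R R-sym r01 r02 r12 {fzero}               {fsuc (fsuc fzero)}   _   = r02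
K₃-relation R R-sym r01 r02 r12 {fsuc fzero}          {fzero}               _   = R-sym r01
K₃-relation R R-sym r01 r02 r12 {fsuc fzero}          {fsuc fzero}          1≢1 = contradiction refl 1≢1
K₃-relation R R-sym r01 r02 r12 {fsuc fzero}          {fsuc (fsuc fzero)}   _   = r12
K₃-relation R R-sym r01 r02 r12 {fsuc (fsuc fzero)}   {fzero}               _   = R-sym r02
K₃-relation R R-sym r01 r02 r12 {fsuc (fsuc fzero)}   {fsuc fzero}          _   = R-sym r12
K₃-relation R R-sym r01 r02 r12 {fsuc (fsuc fzero)}   {fsuc (fsuc fzero)}   2≢2 = contradiction refl 2≢2

even≢odd : ∀ i j → i * 2 ≢ suc (j * 2)
even≢odd zero j ()
even≢odd (suc i) zero ()
even≢odd (suc i) (suc j) e = even≢odd i j (suc-injective (suc-injective e))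

module _ (G : Graph) where

  private
    V : Set
    V = Fin (n G)

    variable
      S T X D : Subset (n G)
      p q r u v w x x' : V

  Apart : Subset (n G) → Subset (n G) → Set
  Apart A C = ∀ {v} → v ∈ A → v ∈ C → ⊥

  Apart-sym : ∀ {A C} → Apart A C → Apart C A
  Apart-sym A#C c a = A#C a c

  TwoEdgesBetween⇒EdgeBetween : ∀ {A C} → TwoEdgesBetween G A C → EdgeBetween G A C
  TwoEdgesBetween⇒EdgeBetween (a , c , _ , _ , a∈ , c∈ , ac , _) = a , c , a∈ , c∈ , ac

  EdgeBetween-sym : ∀ {A C} → EdgeBetween G A C → EdgeBetween G C A
  EdgeBetween-sym (a , c , a∈ , c∈ , ac) = c , a , c∈ , a∈ , Graph.sym G ac

  EdgeBetween-mono : ∀ {A A' C C'} → A ⊆ A' → C ⊆ C' → EdgeBetween G A C → EdgeBetween G A' C'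
  EdgeBetween-mono A⊆ C⊆ (a , c , a∈ , c∈ , ac) = a , c , A⊆ a∈ , C⊆ c∈ , ac

  EdgeBetween-∪ʳ : ∀ {A C} → EdgeBetween G D (A ∪ C) → EdgeBetween G D A ⊎ EdgeBetween G D C
  EdgeBetween-∪ʳ {A = A} {C} (d , z , d∈ , z∈ , dz) with x∈p∪q⁻ A C z∈
  ... | inj₁ z∈A = inj₁ (d , z , d∈ , z∈A , dz)
  ... | inj₂ z∈C = inj₂ (d , z , d∈ , z∈C , dz)

  Apart-mono : ∀ {A A' C C'} → A ⊆ A' → C ⊆ C' → Apart A' C' → Apart A C
  Apart-mono A⊆ C⊆ A'#C' a c = A'#C' (A⊆ a) (C⊆ c)

  Apart-∪ˡ : ∀ {A C} → Apart A C → Apart D C → Apart (A ∪ D) C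
  Apart-∪ˡ {A = A} A#C D#C v∈ v∈C = [ (λ v∈A → A#C v∈A v∈C) , (λ v∈D → D#C v∈D v∈C) ]′ (x∈p∪q⁻ A _ v∈)

  Apart-∪ʳ : ∀ {A C} → Apart D (A ∪ C) → Apart D A × Apart D C
  Apart-∪ʳ {A = A} {C} D#A∪C = (λ v∈D v∈A → D#A∪C v∈D (p⊆p∪q C v∈A))
                             , (λ v∈D v∈C → D#A∪C v∈D (q⊆p∪q A C v∈C))

  PathIn-mono : S ⊆ T → PathIn G S u v → PathIn G T u v
  PathIn-mono S⊆T (here u∈) = here (S⊆T u∈)
  PathIn-mono S⊆T (step u∈ uw P) = step (S⊆T u∈) uw (PathIn-mono S⊆T P)

  start∈ : PathIn G S u v → u ∈ S
  start∈ (here u∈) = u∈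
  start∈ (step u∈ _ _) = u∈

  _++ᵖ_ : PathIn G S u v → PathIn G S v w → PathIn G S u w
  here _ ++ᵖ Q = Q
  step u∈ uw P ++ᵖ Q = step u∈ uw (P ++ᵖ Q)

  reverse : PathIn G S u v → PathIn G S v u
  reverse (here u∈) = here u∈
  reverse (step u∈ uw P) = reverse P ++ᵖ step (start∈ P) (Graph.sym G uw) (here u∈)

  vertices : PathIn G S u v → Subset (n G)
  vertices {u = u} (here _) = ⁅ u ⁆
  vertices {u = u} (step _ _ P) = ⁅ u ⁆ ∪ vertices P

  vertices⊆ : (P : PathIn G S u v) → vertices P ⊆ S
  vertices⊆ {u = u} (here u∈) w∈ rewrite x∈⁅y⁆⇒x≡y u w∈ = u∈
  vertices⊆ {u = u} (step u∈ _ P) w∈ with x∈p∪q⁻ ⁅ u ⁆ (vertices P) w∈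
  ... | inj₁ w∈u rewrite x∈⁅y⁆⇒x≡y u w∈u = u∈
  ... | inj₂ w∈P = vertices⊆ P w∈P

  start∈vertices : (P : PathIn G S u v) → u ∈ vertices P
  start∈vertices {u = u} (here _) = x∈⁅x⁆ u
  start∈vertices {u = u} (step _ _ P) = p⊆p∪q (vertices P) (x∈⁅x⁆ u)

  end∈vertices : (P : PathIn G S u v) → v ∈ vertices P
  end∈vertices {u = u} (here _) = x∈⁅x⁆ u
  end∈vertices {u = u} (step _ _ P) = q⊆p∪q ⁅ u ⁆ (vertices P) (end∈vertices P)

  pathTo : (P : PathIn G S u v) → w ∈ vertices P → PathIn G (vertices P) u w
  pathTo {u = u} (here _) w∈ rewrite x∈⁅y⁆⇒x≡y u w∈ = here (x∈⁅x⁆ u)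
  pathTo {u = u} (step u∈ uw P) w∈ with x∈p∪q⁻ ⁅ u ⁆ (vertices P) w∈
  ... | inj₁ w∈u rewrite x∈⁅y⁆⇒x≡y u w∈u = here (start∈vertices (step u∈ uw P))
  ... | inj₂ w∈P = step (start∈vertices (step u∈ uw P)) uw (PathIn-mono (q⊆p∪q ⁅ u ⁆ (vertices P)) (pathTo P w∈P))

  star-connected : r ∈ S → (∀ {v} → v ∈ S → PathIn G S r v) → Connected G S
  star-connected r∈ reach = (_ , r∈) , λ u∈ v∈ → reverse (reach u∈) ++ᵖ reach v∈

  Connected-vertices : (P : PathIn G S u v) → Connected G (vertices P)
  Connected-vertices P = star-connected (start∈vertices P) (pathTo P)

  Connected-⁅⁆ : (x : V) → Connected G ⁅ x ⁆
  Connected-⁅⁆ x = star-connected (x∈⁅x⁆ x) λ v∈ →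
    subst (PathIn G ⁅ x ⁆ x) (sym (x∈⁅y⁆⇒x≡y x v∈)) (here (x∈⁅x⁆ x))

  Connected-∪ : ∀ {A C} → Connected G A → Connected G C → EdgeBetween G A C → Connected G (A ∪ C)
  Connected-∪ {A} {C} cA cC (a , c , a∈ , c∈ , ac) = star-connected (p⊆p∪q C a∈) reach
    where
      reach : ∀ {v} → v ∈ A ∪ C → PathIn G (A ∪ C) a v
      reach v∈ with x∈p∪q⁻ A C v∈
      ... | inj₁ v∈A = PathIn-mono (p⊆p∪q C) (proj₂ cA a∈ v∈A)
      ... | inj₂ v∈C = step (p⊆p∪q C a∈) ac (PathIn-mono (q⊆p∪q A C) (proj₂ cC c∈ v∈C))

  firstEntry : p ∉ X → PathIn G S p v → v ∈ X →
               ∃₂ λ r z → PathIn G (S ∩ ∁ X) p r × Adj G r z × z ∈ X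
  firstEntry p∉ (here _) v∈ = contradiction v∈ p∉
  firstEntry {X = X} p∉ (step {w = w} p∈ pw P) v∈ with w ∈? X
  ... | yes w∈ = _ , _ , here (x∈p∩q⁺ (p∈ , x∉p⇒x∈∁p p∉)) , pw , w∈
  ... | no w∉ =
    let r , z , R , rz , z∈ = firstEntry w∉ P v∈
    in r , z , step (x∈p∩q⁺ (p∈ , x∉p⇒x∈∁p p∉)) pw R , rz , z∈

  approach : Connected G S → x ∈ S → x ∈ X → p ∈ S → p ∉ X →
             ∃[ D ] Connected G D × D ⊆ S × Apart D X × p ∈ D × EdgeBetween G D X
  approach {S = S} {X = X} cS x∈S x∈X p∈S p∉X =
    let r , z , R , rz , z∈ = firstEntry p∉X (proj₂ cS p∈S x∈S) x∈X
        inside = λ {v} (v∈ : v ∈ vertices R) → x∈p∩q⁻ S (∁ X) (vertices⊆ R v∈)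
    in  vertices R
      , Connected-vertices R
      , (λ v∈ → proj₁ (inside v∈))
      , (λ v∈ → x∈∁p⇒x∉p (proj₂ (inside v∈)))
      , start∈vertices R
      , (r , z , end∈vertices R , z∈ , rz)

  record AdjacentPair (S : Subset (n G)) : Set where
    field
      A C : Subset (n G)
      connectedA : Connected G A
      connectedC : Connected G C
      apart : Apart A C
      A⊆S : A ⊆ S
      C⊆S : C ⊆ S
      edge : EdgeBetween G A C

  swap : AdjacentPair S → AdjacentPair S
  swap P = record
    { A = C ; C = A ; connectedA = connectedC ; connectedC = connectedA
    ; apart = Apart-sym apart ; A⊆S = C⊆S ; C⊆S = A⊆S ; edge = EdgeBetween-sym edge }
    where open AdjacentPair P

  cut : Connected G S → x ∈ S → x' ∈ S → x ≢ x' →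
        Σ (AdjacentPair S) λ P → x ∈ AdjacentPair.A P × x' ∈ AdjacentPair.C P
  cut {x = x} cS x∈ x'∈ x≢x' =
    let D , cD , D⊆S , D#x , x'∈D , Dx =
          approach cS x∈ (x∈⁅x⁆ x) x'∈ (λ x'∈x → x≢x' (sym (x∈⁅y⁆⇒x≡y x x'∈x)))
    in record
         { A = ⁅ x ⁆ ; C = D ; connectedA = Connected-⁅⁆ x ; connectedC = cD
         ; apart = Apart-sym D#x
         ; A⊆S = λ v∈ → subst (_∈ _) (sym (x∈⁅y⁆⇒x≡y x v∈)) x∈
         ; C⊆S = D⊆S ; edge = EdgeBetween-sym Dx }
       , x∈⁅x⁆ x , x'∈D

  growA : (P : AdjacentPair S) → let open AdjacentPair P in
          Connected G D → D ⊆ S → Apart D C → EdgeBetween G D A → AdjacentPair S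
  growA {D = D} P cD D⊆S D#C DA = record
    { A = A ∪ D ; C = C
    ; connectedA = Connected-∪ connectedA cD (EdgeBetween-sym DA)
    ; connectedC = connectedC
    ; apart = Apart-∪ˡ apart D#C
    ; A⊆S = λ v∈ → [ A⊆S , D⊆S ]′ (x∈p∪q⁻ A D v∈)
    ; C⊆S = C⊆S
    ; edge = EdgeBetween-mono (p⊆p∪q D) ⊆-refl edge }
    where open AdjacentPair P

  module _ (P : AdjacentPair S) where
    open AdjacentPair P

    absorb : Connected G S → p ∈ S →
             Σ (AdjacentPair S) λ P' → A ⊆ AdjacentPair.A P' × C ⊆ AdjacentPair.C P'
                                      × (p ∈ AdjacentPair.A P' ⊎ p ∈ AdjacentPair.C P')
    absorb {p = p} cS p∈ with p ∈? (A ∪ C)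
    ... | yes p∈A∪C = P , ⊆-refl , ⊆-refl , x∈p∪q⁻ A C p∈A∪C
    ... | no p∉A∪C
      with approach cS (A⊆S (proj₂ (proj₁ connectedA))) (p⊆p∪q C (proj₂ (proj₁ connectedA))) p∈ p∉A∪C
    ... | D , cD , D⊆S , D#A∪C , p∈D , DA∪C with Apart-∪ʳ D#A∪C | EdgeBetween-∪ʳ DA∪C
    ... | _ , D#C | inj₁ DA =
      growA P cD D⊆S D#C DA , p⊆p∪q D , ⊆-refl , inj₁ (q⊆p∪q A D p∈D)
    ... | D#A , _ | inj₂ DC =
      swap (growA (swap P) cD D⊆S D#A DC) , ⊆-refl , p⊆p∪q D , inj₂ (q⊆p∪q C D p∈D)

  Separates : Subset (n G) → Subset (n G) → V → V → Set
  Separates A C x x' = (x ∈ A × x' ∈ C) ⊎ (x' ∈ A × x ∈ C)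

  split : Connected G S → x ∈ S → x' ∈ S → x ≢ x' → p ∈ S →
          Σ (AdjacentPair S) λ P → let open AdjacentPair P in p ∈ A × Separates A C x x'
  split cS x∈ x'∈ x≢x' p∈ with cut cS x∈ x'∈ x≢x'
  ... | P , x∈A , x'∈C with absorb P cS p∈
  ... | P' , A⊆ , C⊆ , inj₁ p∈A' = P' , p∈A' , inj₁ (A⊆ x∈A , C⊆ x'∈C)
  ... | P' , A⊆ , C⊆ , inj₂ p∈C' = swap P' , p∈C' , inj₂ (C⊆ x'∈C , A⊆ x∈A)

  separated-edges : ∀ {A C y y'} → Separates A C x x' → Adj G x y → Adj G x' y' → y ∈ T → y' ∈ T →
                    EdgeBetween G A T × EdgeBetween G C T
  separated-edges (inj₁ (x∈A , x'∈C)) xy x'y' y∈ y'∈ = (_ , _ , x∈A , y∈ , xy) , (_ , _ , x'∈C , y'∈ , x'y')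
  separated-edges (inj₂ (x'∈A , x∈C)) xy x'y' y∈ y'∈ = (_ , _ , x'∈A , y'∈ , x'y') , (_ , _ , x∈C , y∈ , xy)

  Linked : Subset (n G) → Subset (n G) → Set
  Linked A C = Apart A C × EdgeBetween G A C

  Linked-sym : ∀ {A C} → Linked A C → Linked C A
  Linked-sym (A#C , AC) = Apart-sym A#C , EdgeBetween-sym AC

  record TriangleIn (U : Subset (n G)) (p q : V) : Set where
    field
      model : MinorModel G (Fin 3) _≢_
      inside : ∀ c → MinorModel.branch model c ⊆ U
      p∈ : p ∈ MinorModel.branch model Idx0
      q∈ : q ∈ MinorModel.branch model Idx1

  triangleIn : ∀ {U A B C} → Connected G A → Connected G B → Connected G C →
               Linked A B → Linked A C → Linked B C → A ⊆ U → B ⊆ U → C ⊆ U →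
               p ∈ A → q ∈ B → TriangleIn U p q
  triangleIn {A = A} {B} {C} cA cB cC AB AC BC A⊆U B⊆U C⊆U p∈A q∈B = record
    { model = record
      { branch = branch
      ; connected = λ { fzero → cA ; (fsuc fzero) → cB ; (fsuc (fsuc fzero)) → cC }
      ; disjoint = disjoint
      ; edges = λ a≢b → proj₂ (linked a≢b) }
    ; inside = λ { fzero → A⊆U ; (fsuc fzero) → B⊆U ; (fsuc (fsuc fzero)) → C⊆U }
    ; p∈ = p∈A
    ; q∈ = q∈B }
    where
      branch : Fin 3 → Subset (n G)
      branch = lookup (A ∷ B ∷ C ∷ [])
      linked : ∀ {a b} → a ≢ b → Linked (branch a) (branch b)
      linked = K₃-relation (λ a b → Linked (branch a) (branch b)) Linked-sym AB AC BC
      disjoint : ∀ a b {v} → v ∈ branch a → v ∈ branch b → a ≡ b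
      disjoint a b v∈a v∈b with a ≟ b
      ... | yes a≡b = a≡b
      ... | no a≢b = ⊥-elim (proj₁ (linked a≢b) v∈a v∈b)

  triangle : Connected G S → Connected G T → Apart S T → TwoEdgesBetween G S T →
             p ∈ S → q ∈ T → TriangleIn (S ∪ T) p q
  triangle {S = S} {T} cS cT S#T (x , y , x' , y' , x∈ , y∈ , xy , x'∈ , y'∈ , x'y' , inj₁ x≢x') p∈ q∈
    with split cS x∈ x'∈ x≢x' p∈
  ... | P , p∈A , sep with separated-edges sep xy x'y' y∈ y'∈
  ... | AT , CT =
    triangleIn connectedA cT connectedC
      (Apart-mono A⊆S ⊆-refl S#T , AT) (apart , edge) (Apart-mono ⊆-refl C⊆S (Apart-sym S#T) , EdgeBetween-sym CT)
      (p⊆p∪q T ∘ A⊆S) (q⊆p∪q S T) (p⊆p∪q T ∘ C⊆S) p∈A q∈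
    where open AdjacentPair P
  triangle {S = S} {T} cS cT S#T (x , y , x' , y' , x∈ , y∈ , xy , x'∈ , y'∈ , x'y' , inj₂ y≢y') p∈ q∈
    with split cT y∈ y'∈ y≢y' q∈
  ... | P , q∈A , sep with separated-edges sep (Graph.sym G xy) (Graph.sym G x'y') x∈ x'∈
  ... | AS , CS =
    triangleIn cS connectedA connectedC
      (Apart-mono ⊆-refl A⊆S S#T , EdgeBetween-sym AS) (Apart-mono ⊆-refl C⊆S S#T , EdgeBetween-sym CS) (apart , edge)
      (p⊆p∪q T) (q⊆p∪q S T ∘ A⊆S) (q⊆p∪q S T ∘ C⊆S) p∈ q∈A
    where open AdjacentPair P

  module FromNecklace {k : ℕ} (N : HasNecklaceMinor G k) where

    open ≡-Reasoning

    private
      variable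
        m m' : ℕ

    clamp : ℕ → Fin (suc k)
    clamp m = fromℕ< (s≤s (m⊓n≤n m k))

    toℕ-clamp : m ≤ k → toℕ (clamp m) ≡ m
    toℕ-clamp {m} m≤k = trans (toℕ-fromℕ< (s≤s (m⊓n≤n m k))) (m≤n⇒m⊓n≡m m≤k)

    -- bead m is S_(min m k), so the beads beyond k are copies of S_k.
    bead : ℕ → Subset (n G)
    bead m = proj₁ N (clamp m)

    bead-connected : ∀ m → Connected G (bead m)
    bead-connected m = proj₁ (proj₂ N) (clamp m)

    bead-index : m ≤ k → m' ≤ k → v ∈ bead m → v ∈ bead m' → m ≡ m'
    bead-index {m} {m'} m≤k m'≤k v∈m v∈m' = begin
      m                ≡⟨ sym (toℕ-clamp m≤k) ⟩
      toℕ (clamp m)    ≡⟨ cong toℕ (proj₁ (proj₂ (proj₂ N)) (clamp m) (clamp m') v∈m v∈m') ⟩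
      toℕ (clamp m')   ≡⟨ toℕ-clamp m'≤k ⟩
      m'               ∎

    bead-double : m < k → TwoEdgesBetween G (bead m) (bead (suc m))
    bead-double {m} m<k =
      subst₂ (λ a b → TwoEdgesBetween G (proj₁ N a) (proj₁ N b)) (sym clamp≡inject₁) (sym clamp≡fsuc)
             (proj₂ (proj₂ (proj₂ N)) gap)
      where
        gap : Fin k
        gap = fromℕ< m<k
        clamp≡inject₁ : clamp m ≡ inject₁ gap
        clamp≡inject₁ = toℕ-injective (begin
          toℕ (clamp m)        ≡⟨ toℕ-clamp (<⇒≤ m<k) ⟩
          m                    ≡⟨ toℕ-fromℕ< m<k ⟨
          toℕ gap              ≡⟨ toℕ-inject₁ gap ⟨
          toℕ (inject₁ gap)    ∎)
        clamp≡fsuc : clamp (suc m) ≡ fsuc gap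
        clamp≡fsuc = toℕ-injective (trans (toℕ-clamp m<k) (cong suc (sym (toℕ-fromℕ< m<k))))

    link : m < k → EdgeBetween G (bead m) (bead (suc m))
    link m<k = TwoEdgesBetween⇒EdgeBetween (bead-double m<k)

    anchor : ℕ → V
    anchor m = proj₁ (proj₁ (bead-connected m))

    anchor∈ : ∀ m → anchor m ∈ bead m
    anchor∈ m = proj₂ (proj₁ (bead-connected m))

    -- exit m and entry (suc m) are the ends of one edge from bead m to bead (suc m);
    -- where there is no such bead, any vertex of bead m (resp. bead (suc m)) is used.
    exit : ℕ → V
    exit m with m <? k
    ... | yes m<k = proj₁ (link m<k)
    ... | no _ = anchor m

    entry : ℕ → V
    entry zero = anchor zero
    entry (suc m) with m <? k
    ... | yes m<k = proj₁ (proj₂ (link m<k))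
    ... | no _ = anchor (suc m)

    exit∈ : ∀ m → exit m ∈ bead m
    exit∈ m with m <? k
    ... | yes m<k = proj₁ (proj₂ (proj₂ (link m<k)))
    ... | no _ = anchor∈ m

    entry∈ : ∀ m → entry m ∈ bead m
    entry∈ zero = anchor∈ zero
    entry∈ (suc m) with m <? k
    ... | yes m<k = proj₁ (proj₂ (proj₂ (proj₂ (link m<k))))
    ... | no _ = anchor∈ (suc m)

    exit⟶entry : m < k → Adj G (exit m) (entry (suc m))
    exit⟶entry {m} m<k with m <? k
    ... | yes m<k' = proj₂ (proj₂ (proj₂ (proj₂ (link m<k'))))
    ... | no m≮k = contradiction m<k m≮k

    pair : ℕ → Subset (n G)
    pair i = bead (i * 2) ∪ bead (suc (i * 2))

    pair-index : ∀ i i' → i * 2 < k → i' * 2 < k → v ∈ pair i → v ∈ pair i' → i ≡ i'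
    pair-index i i' i<k i'<k v∈i v∈i'
      with x∈p∪q⁻ (bead (i * 2)) _ v∈i | x∈p∪q⁻ (bead (i' * 2)) _ v∈i'
    ... | inj₁ v∈e | inj₁ v∈e' = *-cancelʳ-≡ i i' 2 (bead-index (<⇒≤ i<k) (<⇒≤ i'<k) v∈e v∈e')
    ... | inj₂ v∈o | inj₂ v∈o' = *-cancelʳ-≡ i i' 2 (suc-injective (bead-index i<k i'<k v∈o v∈o'))
    ... | inj₁ v∈e | inj₂ v∈o' = contradiction (bead-index (<⇒≤ i<k) i'<k v∈e v∈o') (even≢odd i i')
    ... | inj₂ v∈o | inj₁ v∈e' = contradiction (bead-index (<⇒≤ i'<k) i<k v∈e' v∈o) (even≢odd i' i)

    triangleAt : ∀ i → i * 2 < k → TriangleIn (pair i) (entry (i * 2)) (exit (suc (i * 2)))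
    triangleAt i i<k =
      triangle (bead-connected _) (bead-connected _)
               (λ v∈e v∈o → <⇒≢ (n<1+n _) (bead-index (<⇒≤ i<k) i<k v∈e v∈o))
               (bead-double i<k) (entry∈ _) (exit∈ _)

    trianglePath : ∀ {t} → t * 2 ≤ suc k → HasTrianglePathMinor G t
    trianglePath {t} t*2≤1+k = record
      { branch = branch
      ; connected = λ (i , c) → Tri.connected i c
      ; disjoint = disjoint
      ; edges = edges }
      where
        bound : (i : Fin t) → toℕ i * 2 < k
        bound i = ≤-pred (≤-trans (*-monoˡ-≤ 2 (toℕ<n i)) t*2≤1+k)

        tri : (i : Fin t) → TriangleIn (pair (toℕ i)) (entry (toℕ i * 2)) (exit (suc (toℕ i * 2)))
        tri i = triangleAt (toℕ i) (bound i)

        module Tri (i : Fin t) = MinorModel (TriangleIn.model (tri i))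

        branch : TPVertex t → Subset (n G)
        branch (i , c) = Tri.branch i c

        branch⊆pair : ∀ i c → branch (i , c) ⊆ pair (toℕ i)
        branch⊆pair i = TriangleIn.inside (tri i)

        disjoint : ∀ h h' {v} → v ∈ branch h → v ∈ branch h' → h ≡ h'
        disjoint (i , c) (i' , c') v∈ v∈'
          with toℕ-injective {i = i} {j = i'}
                 (pair-index (toℕ i) (toℕ i') (bound i) (bound i') (branch⊆pair i c v∈) (branch⊆pair i' c' v∈'))
        ... | refl = cong (i ,_) (Tri.disjoint i c c' v∈ v∈')

        linkEdge : ∀ i i' → toℕ i' ≡ suc (toℕ i) → EdgeBetween G (branch (i , Idx1)) (branch (i' , Idx0))
        linkEdge i i' i'≡1+i = _ , _ , TriangleIn.q∈ (tri i) , TriangleIn.p∈ (tri i') , adjacent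
          where
            adjacent : Adj G (exit (suc (toℕ i * 2))) (entry (toℕ i' * 2))
            adjacent = subst (λ m → Adj G (exit (suc (toℕ i * 2))) (entry (m * 2))) (sym i'≡1+i)
                             (exit⟶entry (<⇒≤ (subst (λ m → m * 2 < k) i'≡1+i (bound i'))))

        edges : ∀ {h h'} → TPEdge t h h' → EdgeBetween G (branch h) (branch h')
        edges {i , _} (inj₁ (refl , c≢c')) = Tri.edges i c≢c'
        edges {i , _} {i' , _} (inj₂ (inj₁ (i'≡1+i , refl , refl))) = linkEdge i i' i'≡1+i
        edges {i , _} {i' , _} (inj₂ (inj₂ (i≡1+i' , refl , refl))) = EdgeBetween-sym (linkEdge i' i i≡1+i')

  necklace⇒trianglePath : ∀ {k t} → HasNecklaceMinor G k → t * 2 ≤ suc k → HasTrianglePathMinor G t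
  necklace⇒trianglePath N = FromNecklace.trianglePath N

lemma20 : (G : Graph) (k l : ℕ) → IsNM G k → IsTPM G l → suc k / 2 ≤ l
lemma20 G k l (inj₂ (refl , _) , _) _ = z≤n
lemma20 G k l (inj₁ (_ , N) , _) (_ , tpm-max) with suc k / 2 | m/n*n≤m (suc k) 2
... | zero | _ = z≤n
... | suc t | t*2≤1+k = tpm-max (suc t) (s≤s z≤n , necklace⇒trianglePath G N t*2≤1+k)
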